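{- There exist absolute constants $C_1,C_2>0$ and $n_0$ such that for every $n\ge n_0$ and every spanoid $\mathcal S$ on $[n]$ there exist $\ell\ge1$ and sets $S_1,\dots,S_n$ with $|S_i|\le\ell$ and $S_i\subseteq\bigcup_{t\in T}S_t$ whenever $T\models i$ in $\mathcal S$, such that the associated code $C=\{(x|_{S_i})_{i\in[n]}:x\in\{0,1\}^U\}\subseteq\Sigma^n$, $U=\bigcup_iS_i$, $\Sigma=\{0,1\}^\ell$ (which is consistent with $\mathcal S$) satisfies $\log_2|\Sigma|=\ell\le C_1\frac{\log n}{\log\log n}$ and $\dim C=|U|/\ell\ge C_2\frac{\log\log n}{\log n}\,\mathrm{LP}^{cover}(\mathcal S)$.
   Context: A spanoid $\mathcal S$ on $[n]$ is a family of pairs $(S,i)$ with $S\subseteq[n]$, $i\in[n]$ (rules). For $T\subseteq[n]$, $i\in[n]$ write $T\models i$ if there is a sequence $T=T_0,\dots,T_r$ ($r\ge0$) with $i\in T_r$ such that for each $j\in[r]$, $T_j=T_{j-1}\cup\{i_j\}$ where some $S\subseteq T_{j-1}$ has $(S,i_j)\in\mathcal S$. $\mathrm{span}(T)=\{i:T\models i\}$. A set $B$ is closed if $\mathrm{span}(B)=B$, open if its complement is closed; $\mathcal O^*$ is the family of inclusion-minimal nonempty open sets. $\mathrm{LP}^{cover}(\mathcal S)$ is the minimum of $\sum_i x_i$ over $x\ge0$ with $\sum_{i\in F}x_i\ge1$ for all $F\in\mathcal O^*$. For a code $C\subseteq\Sigma^n$, $\dim C=\log|C|/\log|\Sigma|$;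 $C$ is consistent with $\mathcal S$ if for each rule $(S,i)$, $c_i$ is a fixed function of $c|_S$ for all $c\in C$. -}

module Defs where

open import Data.Nat using (ℕ; zero; suc)
open import Data.Fin using (Fin; zero; suc)
open import Data.Fin.Subset using (Subset; _∈_; _⊆_; _∪_; ⁅_⁆; ∁; ⊥; Nonempty)
open import Data.Vec using (Vec; []; _∷_; lookup)
open import Data.Bool using (Bool; true; false; if_then_else_)
open import Data.List using (List)
import Data.List.Membership.Propositional as LM
open import Data.Product using (Σ; _×_; _,_)
open import Data.Integer using (+_)
open import Data.Rational using (ℚ; 0ℚ; 1ℚ; _+_; _≤_; _/_)
open import Relation.Binary.PropositionalEquality using (_≡_)
open import Function using (_∘_)

toℚ : ℕ → ℚ
toℚ k = + k / 1

-- a spanoid on [n] = Fin n : a finite family of rules (S , i)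
Spanoid : ℕ → Set
Spanoid n = List (Subset n × Fin n)

data _⊢_⊨_ {n : ℕ} (𝒮 : Spanoid n) : Subset n → Fin n → Set where
  here : ∀ {T i} → i ∈ T → 𝒮 ⊢ T ⊨ i
  step : ∀ {T i S j} → (S , j) LM.∈ 𝒮 → S ⊆ T → 𝒮 ⊢ (T ∪ ⁅ j ⁆) ⊨ i → 𝒮 ⊢ T ⊨ i

-- B closed: span(B) = B (span(B) ⊇ B always holds)
Closed : ∀ {n} → Spanoid n → Subset n → Set
Closed 𝒮 B = ∀ i → 𝒮 ⊢ B ⊨ i → i ∈ B

Open : ∀ {n} → Spanoid n → Subset n → Set
Open 𝒮 F = Closed 𝒮 (∁ F)

MinOpen : ∀ {n} → Spanoid n → Subset n → Set
MinOpen 𝒮 F = Nonempty F × Open 𝒮 F ×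
  (∀ G → Nonempty G → Open 𝒮 G → G ⊆ F → F ⊆ G)

sumℚ : ∀ {n} → (Fin n → ℚ) → ℚ
sumℚ {zero} x = 0ℚ
sumℚ {suc n} x = x zero + sumℚ (x ∘ suc)

sumOver : ∀ {n} → Subset n → (Fin n → ℚ) → ℚ
sumOver F x = sumℚ (λ i → if lookup F i then x i else 0ℚ)

FeasibleCover : ∀ {n} → Spanoid n → (Fin n → ℚ) → Set
FeasibleCover 𝒮 x = (∀ i → 0ℚ ≤ x i) × (∀ F → MinOpen 𝒮 F → 1ℚ ≤ sumOver F x)

IsLPcover : ∀ {n} → Spanoid n → ℚ → Set
IsLPcover 𝒮 v = Σ (_ → ℚ) (λ x → FeasibleCover 𝒮 x × sumℚ x ≡ v)
              × (∀ y → FeasibleCover 𝒮 y → v ≤ sumℚ y)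

unionOver : ∀ {n m} → Subset n → (Fin n → Subset m) → Subset m
unionOver [] S = ⊥
unionOver (b ∷ T) S = (if b then S zero else ⊥) ∪ unionOver T (S ∘ suc)

module Submission where

-- Multiplicative weights. Coordinate i carries weight β ^ (load i), where load i counts
-- the rounds so far whose set contained i; each round picks the nonempty open set G of least
-- total weight α and puts the round into S j for every j ∈ G. A set T with T ⊨ i meets every
-- open set containing i, so S i ⊆ ⋃_{t ∈ T} S t. We stop just before some load exceeds ℓ,
-- so ∣ S i ∣ ≤ ℓ and ∣ U ∣ is the number N of rounds. Scaling the weights by 1/α gives a
-- feasible fractional cover, so α · LP ≤ D (the total weight) and each round multiplies D by
-- at most 1 + b / LP, where β = b + 1 = 2 ^ k with k ≈ ½ log log n. Since D ends above
-- β ^ ℓ > n ^ 2 with ℓ ≈ 2 log n / k, this forces N ≥ ℓ · LP · log log n / log n; when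
-- LP < 2 b the cruder bound D ≤ β ^ t · n already suffices.

open import Defs

open import Data.Bool using (true; false; if_then_else_)
open import Data.Fin using (Fin; zero; suc)
open import Data.Fin.Properties using (any?)
open import Data.Fin.Subset using (Subset; _∈_; _⊆_; _∪_; ⁅_⁆; ⊤; ∁; ∣_∣; Nonempty)
open import Data.Fin.Subset.Properties
  using ( _∈?_; _⊆?_; anySubset?; nonempty?; x∈p∪q⁻; x∈p∪q⁺; x∈⁅x⁆; x∈⁅y⁆⇒x≡y
        ; x∈∁p⇒x∉p; x∉p⇒x∈∁p; ∈⊤; ⊆⊤; ⊆-antisym; ∣⊤∣≡n)
import Data.Integer as ℤ
import Data.Integer.Properties as ℤ
open import Data.List.Relation.Unary.All as All using (All)
open import Data.Nat
open import Data.Nat.Coprimality as Coprime using (1-coprimeTo)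
open import Data.Nat.DivMod using (_/_; _%_; m≡m%n+[m/n]*n; m%n<n; m/n*n≤m; m≥n⇒m/n>0)
open import Data.Nat.Induction using (<-wellFounded)
open import Data.Nat.Logarithm using (⌊log₂_⌋; ⌊log₂⌋-mono-≤; ⌊log₂[2^n]⌋≡n; ⌊log₂⌊n/2⌋⌋≡⌊log₂n⌋∸1)
open import Data.Nat.Properties
open import Data.Nat.Solver using (module +-*-Solver)
open import Data.Product using (Σ; Σ-syntax; ∃-syntax; _×_; _,_; proj₁; proj₂)
open import Data.Rational using (ℚ; mkℚ; 0ℚ; 1ℚ; *≤*)
import Data.Rational as ℚ
import Data.Rational.Properties as ℚ
open import Data.Sum using (inj₁; inj₂)
open import Data.Vec using ([]; _∷_; lookup; here; there)
open import Data.Vec.Properties using ([]=⇒lookup; lookup⇒[]=)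
open import Function using (id; _∘_)
open import Induction.WellFounded using (Acc; acc)
open import Level using (0ℓ)
open import Relation.Binary.PropositionalEquality
open import Relation.Nullary using (¬_; yes; no; contradiction)
open import Relation.Nullary.Decidable using (map′; _×-dec_; _→-dec_)
open import Relation.Unary using (Pred; Decidable)

open import Algebra.Properties.Semiring.Sum +-*-semiring
  using (sum; sum-cong-≗; ∑-distrib-+; *-distribˡ-sum)

crossing : ∀ {p} {P : Pred ℕ p} → Decidable P → ¬ P 0 → ∀ {m} → P m →
           ∃[ t ] ¬ P t × P (suc t)
crossing P? ¬P0 {zero}  Pm = contradiction Pm ¬P0
crossing P? ¬P0 {suc m} Psm with P? m
... | yes Pm = crossing P? ¬P0 Pm
... | no ¬Pm = m , ¬Pm , Psm

⌊n/2⌋+⌊n/2⌋≤n : ∀ n → ⌊ n /2⌋ + ⌊ n /2⌋ ≤ n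
⌊n/2⌋+⌊n/2⌋≤n n = ≤-trans (+-monoʳ-≤ ⌊ n /2⌋ (⌊n/2⌋≤⌈n/2⌉ n)) (≤-reflexive (⌊n/2⌋+⌈n/2⌉≡n n))

n≤1+⌊n/2⌋+⌊n/2⌋ : ∀ n → n ≤ suc (⌊ n /2⌋ + ⌊ n /2⌋)
n≤1+⌊n/2⌋+⌊n/2⌋ zero          = z≤n
n≤1+⌊n/2⌋+⌊n/2⌋ (suc zero)    = ≤-refl
n≤1+⌊n/2⌋+⌊n/2⌋ (suc (suc n)) =
  s≤s (≤-trans (s≤s (n≤1+⌊n/2⌋+⌊n/2⌋ n)) (≤-reflexive (cong suc (sym (+-suc ⌊ n /2⌋ ⌊ n /2⌋)))))

2^e≤m⇒e≤⌊log₂m⌋ : ∀ {e m} → 2 ^ e ≤ m → e ≤ ⌊log₂ m ⌋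
2^e≤m⇒e≤⌊log₂m⌋ {e} {m} 2^e≤m = subst (_≤ ⌊log₂ m ⌋) (⌊log₂[2^n]⌋≡n e) (⌊log₂⌋-mono-≤ 2^e≤m)

2^⌊log₂n⌋≤n : ∀ n .{{_ : NonZero n}} → 2 ^ ⌊log₂ n ⌋ ≤ n
2^⌊log₂n⌋≤n n = go n (<-wellFounded n)
  where
  go : ∀ n .{{_ : NonZero n}} → Acc _<_ n → 2 ^ ⌊log₂ n ⌋ ≤ n
  go 1 _ = ≤-reflexive (cong (2 ^_) (⌊log₂[2^n]⌋≡n 0))
  go n@(suc (suc m)) (acc smaller) = begin
    2 ^ ⌊log₂ n ⌋            ≡⟨ cong (2 ^_) log-half ⟩
    2 * 2 ^ ⌊log₂ ⌊ n /2⌋ ⌋  ≤⟨ *-monoʳ-≤ 2 (go ⌊ n /2⌋ (smaller (⌊n/2⌋<n (suc m)))) ⟩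
    2 * ⌊ n /2⌋              ≡⟨ cong (⌊ n /2⌋ +_) (+-identityʳ ⌊ n /2⌋) ⟩
    ⌊ n /2⌋ + ⌊ n /2⌋        ≤⟨ ⌊n/2⌋+⌊n/2⌋≤n n ⟩
    n                        ∎
    where
    open ≤-Reasoning
    log-half : ⌊log₂ n ⌋ ≡ suc ⌊log₂ ⌊ n /2⌋ ⌋
    log-half = trans (sym (m+[n∸m]≡n 1≤⌊log₂n⌋))
                     (cong suc (sym (⌊log₂⌊n/2⌋⌋≡⌊log₂n⌋∸1 (suc (suc m)))))
      where
      1≤⌊log₂n⌋ : 1 ≤ ⌊log₂ n ⌋
      1≤⌊log₂n⌋ = 2^e≤m⇒e≤⌊log₂m⌋ {1} {n} (s≤s (s≤s z≤n))

2^16≤⌊log₂n⌋ : ∀ {n} → 2 ^ 2 ^ 16 ≤ n → 2 ^ 16 ≤ ⌊log₂ n ⌋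
2^16≤⌊log₂n⌋ {n} = 2^e≤m⇒e≤⌊log₂m⌋ {2 ^ 16} {n}

16≤⌊log₂⌊log₂n⌋⌋ : ∀ {n} → 2 ^ 2 ^ 16 ≤ n → 16 ≤ ⌊log₂ ⌊log₂ n ⌋ ⌋
16≤⌊log₂⌊log₂n⌋⌋ {n} n₀≤n = 2^e≤m⇒e≤⌊log₂m⌋ {16} {⌊log₂ n ⌋} (2^16≤⌊log₂n⌋ n₀≤n)

2^⌊log₂⌊log₂n⌋⌋≤⌊log₂n⌋ : ∀ {n} → 2 ^ 2 ^ 16 ≤ n → 2 ^ ⌊log₂ ⌊log₂ n ⌋ ⌋ ≤ ⌊log₂ n ⌋
2^⌊log₂⌊log₂n⌋⌋≤⌊log₂n⌋ {n} n₀≤n = 2^⌊log₂n⌋≤n ⌊log₂ n ⌋ {{>-nonZero (≤-trans (s≤s z≤n) (2^16≤⌊log₂n⌋ n₀≤n))}}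

m<[1+m/n]*n : ∀ m n .{{_ : NonZero n}} → m < suc (m / n) * n
m<[1+m/n]*n m n = begin-strict
  m                  ≡⟨ m≡m%n+[m/n]*n m n ⟩
  m % n + m / n * n  <⟨ +-monoˡ-< (m / n * n) (m%n<n m n) ⟩
  n + m / n * n      ∎
  where open ≤-Reasoning

n<2^[1+⌊log₂n⌋] : ∀ n → n < 2 ^ suc ⌊log₂ n ⌋
n<2^[1+⌊log₂n⌋] n = ≰⇒> (n≮n ⌊log₂ n ⌋ ∘ 2^e≤m⇒e≤⌊log₂m⌋)

2^-cancel-≤ : ∀ {m n} → 2 ^ m ≤ 2 ^ n → m ≤ n
2^-cancel-≤ {m} {n} 2^m≤2^n = subst (m ≤_) (⌊log₂[2^n]⌋≡n n) (2^e≤m⇒e≤⌊log₂m⌋ 2^m≤2^n)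

24*k≤2^k : ∀ {k} → 8 ≤′ k → 24 * k ≤ 2 ^ k
24*k≤2^k ≤′-refl = m≤m+n 192 64
24*k≤2^k {suc k} (≤′-step 8≤′k) = begin
  24 * suc k        ≡⟨ *-suc 24 k ⟩
  24 + 24 * k       ≤⟨ +-mono-≤ 24≤2^k (24*k≤2^k 8≤′k) ⟩
  2 ^ k + 2 ^ k     ≡⟨ cong (2 ^ k +_) (sym (+-identityʳ (2 ^ k))) ⟩
  2 ^ suc k         ∎
  where
  open ≤-Reasoning
  24≤2^k : 24 ≤ 2 ^ k
  24≤2^k = ≤-trans (m≤m+n 24 232) (^-monoʳ-≤ 2 (≤′⇒≤ 8≤′k))

[m+o]*n≤m*[n+o] : ∀ {m n} o → n ≤ m → (m + o) * n ≤ m * (n + o)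
[m+o]*n≤m*[n+o] {m} {n} o n≤m = begin
  (m + o) * n    ≡⟨ *-distribʳ-+ n m o ⟩
  m * n + o * n  ≤⟨ +-monoʳ-≤ (m * n) (*-monoʳ-≤ o n≤m) ⟩
  m * n + o * m  ≡⟨ cong (m * n +_) (*-comm o m) ⟩
  m * n + m * o  ≡⟨ *-distribˡ-+ m n o ⟨
  m * (n + o)    ∎
  where open ≤-Reasoning

-- Sequences of bounded growth rate

module BoundedGrowth (D : ℕ → ℕ) (b V : ℕ) .{{_ : NonZero V}}
                     (growth : ∀ t → D (suc t) * V ≤ D t * (V + b)) where

  open ≤-Reasoning

  -- D (s + t) ≤ D t · V / (V − b s), written without division.
  D[s+t]*W≤D[t]*V : ∀ s t W → b * s + W ≡ V → D (s + t) * W ≤ D t * V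
  D[s+t]*W≤D[t]*V zero t W bs+W≡V =
    *-monoʳ-≤ (D t) (≤-reflexive (trans (cong (_+ W) (sym (*-zeroʳ b))) bs+W≡V))
  D[s+t]*W≤D[t]*V (suc s) t W bs+W≡V = *-cancelʳ-≤ _ _ V (begin
    D (suc u) * W * V        ≡⟨ *-assoc (D (suc u)) W V ⟩
    D (suc u) * (W * V)      ≡⟨ cong (D (suc u) *_) (*-comm W V) ⟩
    D (suc u) * (V * W)      ≡⟨ *-assoc (D (suc u)) V W ⟨
    D (suc u) * V * W        ≤⟨ *-monoˡ-≤ W (growth u) ⟩
    D u * (V + b) * W        ≡⟨ *-assoc (D u) (V + b) W ⟩
    D u * ((V + b) * W)      ≤⟨ *-monoʳ-≤ (D u) ([m+o]*n≤m*[n+o] b W≤V) ⟩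
    D u * (V * (W + b))      ≡⟨ cong (D u *_) (*-comm V (W + b)) ⟩
    D u * ((W + b) * V)      ≡⟨ *-assoc (D u) (W + b) V ⟨
    D u * (W + b) * V        ≤⟨ *-monoˡ-≤ V (D[s+t]*W≤D[t]*V s t (W + b) bs+[W+b]≡V) ⟩
    D t * V * V              ∎)
    where
    u : ℕ
    u = s + t
    W≤V : W ≤ V
    W≤V = subst (W ≤_) bs+W≡V (m≤n+m W (b * suc s))
    bs+[W+b]≡V : b * s + (W + b) ≡ V
    bs+[W+b]≡V = begin-equality
      b * s + (W + b)  ≡⟨ cong (b * s +_) (+-comm W b) ⟩
      b * s + (b + W)  ≡⟨ +-assoc (b * s) b W ⟨
      b * s + b + W    ≡⟨ cong (_+ W) (+-comm (b * s) b) ⟩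
      b + b * s + W    ≡⟨ cong (_+ W) (*-suc b s) ⟨
      b * suc s + W    ≡⟨ bs+W≡V ⟩
      V                ∎

  D[q+t]≤2*D[t] : ∀ q → b * q + b * q ≤ V → ∀ t → D (q + t) ≤ 2 * D t
  D[q+t]≤2*D[t] q 2bq≤V t = *-cancelʳ-≤ _ _ V (begin
    D (q + t) * V              ≡⟨ cong (D (q + t) *_) bq+W≡V ⟨
    D (q + t) * (b * q + W)    ≤⟨ *-monoʳ-≤ (D (q + t)) (+-monoˡ-≤ W bq≤W) ⟩
    D (q + t) * (W + W)        ≡⟨ *-distribˡ-+ (D (q + t)) W W ⟩
    D (q + t) * W + D (q + t) * W  ≡⟨ cong (D (q + t) * W +_) (+-identityʳ (D (q + t) * W)) ⟨
    2 * (D (q + t) * W)        ≤⟨ *-monoʳ-≤ 2 (D[s+t]*W≤D[t]*V q t W bq+W≡V) ⟩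
    2 * (D t * V)              ≡⟨ *-assoc 2 (D t) V ⟨
    2 * D t * V                ∎)
    where
    W : ℕ
    W = V ∸ b * q
    bq+W≡V : b * q + W ≡ V
    bq+W≡V = m+[n∸m]≡n (≤-trans (m≤m+n (b * q) (b * q)) 2bq≤V)
    bq≤W : b * q ≤ W
    bq≤W = +-cancelˡ-≤ (b * q) (b * q) W (subst (b * q + b * q ≤_) (sym bq+W≡V) 2bq≤V)

  D[j*q]≤2^j*D[0] : ∀ q → b * q + b * q ≤ V → ∀ j → D (j * q) ≤ 2 ^ j * D 0
  D[j*q]≤2^j*D[0] q 2bq≤V zero = ≤-reflexive (sym (+-identityʳ (D 0)))
  D[j*q]≤2^j*D[0] q 2bq≤V (suc j) = begin
    D (q + j * q)        ≤⟨ D[q+t]≤2*D[t] q 2bq≤V (j * q) ⟩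
    2 * D (j * q)        ≤⟨ *-monoʳ-≤ 2 (D[j*q]≤2^j*D[0] q 2bq≤V j) ⟩
    2 * (2 ^ j * D 0)    ≡⟨ *-assoc 2 (2 ^ j) (D 0) ⟨
    2 ^ suc j * D 0      ∎

toℚ≡mkℚ : ∀ k → toℚ k ≡ mkℚ (ℤ.+ k) 0 (Coprime.sym (1-coprimeTo k))
toℚ≡mkℚ k = ℚ.normalize-coprime (Coprime.sym (1-coprimeTo k))

toℚ-+ : ∀ a b → toℚ (a + b) ≡ toℚ a ℚ.+ toℚ b
toℚ-+ a b
  rewrite toℚ≡mkℚ a | toℚ≡mkℚ b | *-identityʳ a | *-identityʳ b | ℤ.+◃n≡+n a | ℤ.+◃n≡+n b = refl

toℚ-* : ∀ a b → toℚ (a * b) ≡ toℚ a ℚ.* toℚ b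
toℚ-* a b rewrite toℚ≡mkℚ a | toℚ≡mkℚ b | ℤ.+◃n≡+n (a * b) = refl

toℚ-mono-≤ : ∀ {a b} → a ≤ b → toℚ a ℚ.≤ toℚ b
toℚ-mono-≤ {a} {b} a≤b rewrite toℚ≡mkℚ a | toℚ≡mkℚ b =
  *≤* (subst₂ ℤ._≤_ (sym (ℤ.*-identityʳ (ℤ.+ a))) (sym (ℤ.*-identityʳ (ℤ.+ b))) (ℤ.+≤+ a≤b))

toℚ-cancel-≤ : ∀ {a b} → toℚ a ℚ.≤ toℚ b → a ≤ b
toℚ-cancel-≤ {a} {b} a≤b rewrite toℚ≡mkℚ a | toℚ≡mkℚ b with a≤b
... | *≤* a*1≤b*1 =
  ℤ.drop‿+≤+ (subst₂ ℤ._≤_ (ℤ.*-identityʳ (ℤ.+ a)) (ℤ.*-identityʳ (ℤ.+ b)) a*1≤b*1)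

toℚ-nonNeg : ∀ k → ℚ.NonNegative (toℚ k)
toℚ-nonNeg k rewrite toℚ≡mkℚ k = _

toℚ-pos : ∀ k .{{_ : NonZero k}} → ℚ.Positive (toℚ k)
toℚ-pos (suc k) rewrite toℚ≡mkℚ (suc k) = _

floorℕ : ∀ v → 0ℚ ℚ.≤ v → ∃[ V ] toℚ V ℚ.≤ v × v ℚ.≤ toℚ (suc V)
floorℕ v@(mkℚ (ℤ.+ p) d _) _ = V , V≤v , v≤1+V
  where
  V = p / suc d
  V≤v : toℚ V ℚ.≤ v
  V≤v rewrite toℚ≡mkℚ V = *≤* (subst₂ ℤ._≤_ (ℤ.pos-* V (suc d)) (ℤ.pos-* p 1)
    (ℤ.+≤+ (≤-trans (m/n*n≤m p (suc d)) (≤-reflexive (sym (*-identityʳ p))))))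
  v≤1+V : v ℚ.≤ toℚ (suc V)
  v≤1+V rewrite toℚ≡mkℚ (suc V) = *≤* (subst₂ ℤ._≤_ (ℤ.pos-* p 1) (ℤ.pos-* (suc V) (suc d))
    (ℤ.+≤+ (begin
      p * 1                          ≡⟨ *-identityʳ p ⟩
      p                              ≡⟨ m≡m%n+[m/n]*n p (suc d) ⟩
      p % suc d + V * suc d          ≤⟨ +-monoˡ-≤ (V * suc d) (<⇒≤ (m%n<n p (suc d))) ⟩
      suc d + V * suc d              ∎)))
    where open ≤-Reasoning
floorℕ (mkℚ ℤ.-[1+ p ] d _) (*≤* ())

toℚ[c]*v≤toℚ[M] : ∀ {c u M v} → c * u ≤ M → v ℚ.≤ toℚ u → toℚ c ℚ.* v ℚ.≤ toℚ M
toℚ[c]*v≤toℚ[M] {c} {u} {M} {v} c*u≤M v≤u = begin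
  toℚ c ℚ.* v        ≤⟨ ℚ.*-monoˡ-≤-nonNeg (toℚ c) {{toℚ-nonNeg c}} v≤u ⟩
  toℚ c ℚ.* toℚ u    ≡⟨ toℚ-* c u ⟨
  toℚ (c * u)        ≤⟨ toℚ-mono-≤ c*u≤M ⟩
  toℚ M              ∎
  where open ℚ.≤-Reasoning

sum-mono-≤ : ∀ {n} {f g : Fin n → ℕ} → (∀ i → f i ≤ g i) → sum f ≤ sum g
sum-mono-≤ {zero}  f≤g = z≤n
sum-mono-≤ {suc n} f≤g = +-mono-≤ (f≤g zero) (sum-mono-≤ (f≤g ∘ suc))

f[i]≤sum[f] : ∀ {n} (f : Fin n → ℕ) i → f i ≤ sum f
f[i]≤sum[f] f zero    = m≤m+n (f zero) _
f[i]≤sum[f] f (suc i) = ≤-trans (f[i]≤sum[f] (f ∘ suc) i) (m≤n+m _ (f zero))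

sum-const : ∀ n c → sum {n} (λ _ → c) ≡ n * c
sum-const zero    c = refl
sum-const (suc n) c = cong (c +_) (sum-const n c)

weight : ∀ {n} → Subset n → (Fin n → ℕ) → ℕ
weight F w = sum (λ i → if lookup F i then w i else 0)

weight≤sum : ∀ {n} (F : Subset n) w → weight F w ≤ sum w
weight≤sum F w = sum-mono-≤ restrict≤
  where
  restrict≤ : ∀ i → (if lookup F i then w i else 0) ≤ w i
  restrict≤ i with lookup F i
  ... | true  = ≤-refl
  ... | false = z≤n

∈⇒≤weight : ∀ {n} {F : Subset n} {i} w → i ∈ F → w i ≤ weight F w
∈⇒≤weight {F = F} {i} w i∈F =
  subst (_≤ weight F w) (cong (λ b → if b then w i else 0) ([]=⇒lookup i∈F))
        (f[i]≤sum[f] (λ j → if lookup F j then w j else 0) i)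

sumℚ-cong : ∀ {n} {x y : Fin n → ℚ} → (∀ i → x i ≡ y i) → sumℚ x ≡ sumℚ y
sumℚ-cong {zero}  x≗y = refl
sumℚ-cong {suc n} x≗y = cong₂ ℚ._+_ (x≗y zero) (sumℚ-cong (x≗y ∘ suc))

sumℚ-nonNeg : ∀ {n} {x : Fin n → ℚ} → (∀ i → 0ℚ ℚ.≤ x i) → 0ℚ ℚ.≤ sumℚ x
sumℚ-nonNeg {zero}  x≥0 = ℚ.≤-refl
sumℚ-nonNeg {suc n} x≥0 = ℚ.+-mono-≤ (x≥0 zero) (sumℚ-nonNeg (x≥0 ∘ suc))

sumℚ-zero : ∀ n → sumℚ {n} (λ _ → 0ℚ) ≡ 0ℚ
sumℚ-zero zero    = refl
sumℚ-zero (suc n) = cong (0ℚ ℚ.+_) (sumℚ-zero n)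

sumℚ-toℚ-* : ∀ {n} (f : Fin n → ℕ) c → sumℚ (λ i → toℚ (f i) ℚ.* c) ≡ toℚ (sum f) ℚ.* c
sumℚ-toℚ-* {zero}  f c = sym (ℚ.*-zeroˡ c)
sumℚ-toℚ-* {suc n} f c = begin
  toℚ (f zero) ℚ.* c ℚ.+ sumℚ (λ i → toℚ (f (suc i)) ℚ.* c)  ≡⟨ cong (toℚ (f zero) ℚ.* c ℚ.+_) (sumℚ-toℚ-* (f ∘ suc) c) ⟩
  toℚ (f zero) ℚ.* c ℚ.+ toℚ Σrest ℚ.* c                     ≡⟨ ℚ.*-distribʳ-+ c (toℚ (f zero)) (toℚ Σrest) ⟨
  (toℚ (f zero) ℚ.+ toℚ Σrest) ℚ.* c                         ≡⟨ cong (ℚ._* c) (toℚ-+ (f zero) Σrest) ⟨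
  toℚ (sum f) ℚ.* c                                          ∎
  where
  open ≡-Reasoning
  Σrest : ℕ
  Σrest = sum (f ∘ suc)

sumOver-toℚ-* : ∀ {n} (F : Subset n) w c → sumOver F (λ i → toℚ (w i) ℚ.* c) ≡ toℚ (weight F w) ℚ.* c
sumOver-toℚ-* F w c = trans (sumℚ-cong restrict-toℚ) (sumℚ-toℚ-* (λ i → if lookup F i then w i else 0) c)
  where
  restrict-toℚ : ∀ i → (if lookup F i then toℚ (w i) ℚ.* c else 0ℚ)
                       ≡ toℚ (if lookup F i then w i else 0) ℚ.* c
  restrict-toℚ i with lookup F i
  ... | true  = refl
  ... | false = sym (ℚ.*-zeroˡ c)

module _ {n p} {P : Pred (Subset n) p} (P? : Decidable P) (w : Subset n → ℕ) where

  lightest : ∀ {F} → P F → Σ[ G ∈ Subset n ] P G × (∀ H → P H → w G ≤ w H)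
  lightest {F} = descend F (<-wellFounded (w F))
    where
    descend : ∀ F → Acc _<_ (w F) → P F → Σ[ G ∈ Subset n ] P G × (∀ H → P H → w G ≤ w H)
    descend F (acc lighter) PF with anySubset? (λ H → P? H ×-dec w H <? w F)
    ... | yes (H , PH , H<F) = descend H (lighter H<F) PH
    ... | no ∄lighter        = F , PF , λ H PH → ≮⇒≥ (λ H<F → ∄lighter (H , PH , H<F))

-- Closure under each single rule: decidable, and equivalent to Closed.
RuleClosed : ∀ {n} → Spanoid n → Subset n → Set
RuleClosed 𝒮 B = All (λ (S , j) → S ⊆ B → j ∈ B) 𝒮

ruleClosed? : ∀ {n} (𝒮 : Spanoid n) → Decidable (RuleClosed 𝒮)
ruleClosed? 𝒮 B = All.all? (λ (S , j) → S ⊆? B →-dec j ∈? B) 𝒮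

ruleClosed-⊨ : ∀ {n} {𝒮 : Spanoid n} {B T i} → RuleClosed 𝒮 B → T ⊆ B → 𝒮 ⊢ T ⊨ i → i ∈ B
ruleClosed-⊨ closed T⊆B (here i∈T) = T⊆B i∈T
ruleClosed-⊨ {T = T} closed T⊆B (step {j = j} rule S⊆T T∪j⊨i) = ruleClosed-⊨ closed T∪j⊆B T∪j⊨i
  where
  T∪j⊆B : T ∪ ⁅ j ⁆ ⊆ _
  T∪j⊆B x∈T∪j with x∈p∪q⁻ T ⁅ j ⁆ x∈T∪j
  ... | inj₁ x∈T = T⊆B x∈T
  ... | inj₂ x∈j rewrite x∈⁅y⁆⇒x≡y j x∈j = All.lookup closed rule (T⊆B ∘ S⊆T)

Closed⇒RuleClosed : ∀ {n} {𝒮 : Spanoid n} {B} → Closed 𝒮 B → RuleClosed 𝒮 B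
Closed⇒RuleClosed closed =
  All.tabulate λ rule S⊆B → closed _ (step rule S⊆B (here (x∈p∪q⁺ (inj₂ (x∈⁅x⁆ _)))))

closed? : ∀ {n} (𝒮 : Spanoid n) → Decidable (Closed 𝒮)
closed? 𝒮 B = map′ (λ rc i → ruleClosed-⊨ rc id) Closed⇒RuleClosed (ruleClosed? 𝒮 B)

open-meets-⊨ : ∀ {n} {𝒮 : Spanoid n} {F T i} → Open 𝒮 F → 𝒮 ⊢ T ⊨ i → i ∈ F → ∃[ s ] s ∈ T × s ∈ F
open-meets-⊨ {F = F} {T} {i} F-open T⊨i i∈F with any? (λ s → s ∈? T ×-dec s ∈? F)
... | yes meet = meet
... | no ∄meet = contradiction i∈F (x∈∁p⇒x∉p (ruleClosed-⊨ (Closed⇒RuleClosed F-open) T⊆∁F T⊨i))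
  where
  T⊆∁F : T ⊆ ∁ F
  T⊆∁F s∈T = x∉p⇒x∈∁p (λ s∈F → ∄meet (_ , s∈T , s∈F))

NonemptyOpen : ∀ {n} → Spanoid n → Subset n → Set
NonemptyOpen 𝒮 F = Nonempty F × Open 𝒮 F

nonemptyOpen? : ∀ {n} (𝒮 : Spanoid n) → Decidable (NonemptyOpen 𝒮)
nonemptyOpen? 𝒮 F = nonempty? F ×-dec closed? 𝒮 (∁ F)

MinOpen⇒NonemptyOpen : ∀ {n} {𝒮 : Spanoid n} {F} → MinOpen 𝒮 F → NonemptyOpen 𝒮 F
MinOpen⇒NonemptyOpen (nonempty , F-open , _) = nonempty , F-open

-- w / a is a feasible fractional cover.
*-LPcover≤sum : ∀ {n} {𝒮 : Spanoid n} {v} (w : Fin n → ℕ) a .{{_ : NonZero a}} →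
                (∀ y → FeasibleCover 𝒮 y → v ℚ.≤ sumℚ y) →
                (∀ F → MinOpen 𝒮 F → a ≤ weight F w) →
                toℚ a ℚ.* v ℚ.≤ toℚ (sum w)
*-LPcover≤sum {𝒮 = 𝒮} {v} w a v≤feasible a≤weight = begin
  toℚ a ℚ.* v                       ≤⟨ ℚ.*-monoˡ-≤-nonNeg (toℚ a) (v≤feasible y y-feasible) ⟩
  toℚ a ℚ.* sumℚ y                  ≡⟨ cong (toℚ a ℚ.*_) (sumℚ-toℚ-* w c) ⟩
  toℚ a ℚ.* (toℚ (sum w) ℚ.* c)     ≡⟨ cong (toℚ a ℚ.*_) (ℚ.*-comm (toℚ (sum w)) c) ⟩
  toℚ a ℚ.* (c ℚ.* toℚ (sum w))     ≡⟨ ℚ.*-assoc (toℚ a) c (toℚ (sum w)) ⟨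
  toℚ a ℚ.* c ℚ.* toℚ (sum w)       ≡⟨ cong (ℚ._* toℚ (sum w)) (ℚ.*-inverseʳ (toℚ a)) ⟩
  1ℚ ℚ.* toℚ (sum w)                ≡⟨ ℚ.*-identityˡ (toℚ (sum w)) ⟩
  toℚ (sum w)                       ∎
  where
  open ℚ.≤-Reasoning
  instance
    a-pos : ℚ.Positive (toℚ a)
    a-pos = toℚ-pos a
    a-nonNeg : ℚ.NonNegative (toℚ a)
    a-nonNeg = ℚ.pos⇒nonNeg (toℚ a)
    a-nonZero : ℚ.NonZero (toℚ a)
    a-nonZero = ℚ.pos⇒nonZero (toℚ a)
  c : ℚ
  c = ℚ.1/ toℚ a
  instance
    c-nonNeg : ℚ.NonNegative c
    c-nonNeg = ℚ.pos⇒nonNeg c {{ℚ.1/pos⇒pos (toℚ a)}}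
  y : Fin _ → ℚ
  y i = toℚ (w i) ℚ.* c
  y-feasible : FeasibleCover 𝒮 y
  y-feasible = y≥0 , covers
    where
    y≥0 : ∀ i → 0ℚ ℚ.≤ y i
    y≥0 i = ℚ.≤-trans (ℚ.≤-reflexive (sym (ℚ.*-zeroˡ c)))
                      (ℚ.*-monoʳ-≤-nonNeg c (toℚ-mono-≤ {0} {w i} z≤n))
    covers : ∀ F → MinOpen 𝒮 F → 1ℚ ℚ.≤ sumOver F y
    covers F F-min = begin
      1ℚ                          ≡⟨ ℚ.*-inverseʳ (toℚ a) ⟨
      toℚ a ℚ.* c                 ≤⟨ ℚ.*-monoʳ-≤-nonNeg c (toℚ-mono-≤ (a≤weight F F-min)) ⟩
      toℚ (weight F w) ℚ.* c      ≡⟨ sumOver-toℚ-* F w c ⟨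
      sumOver F y                 ∎

-- The multiplicative-weights code

∈-by-lookup : ∀ {m k} {p : Subset m} {q : Subset k} {x y} → lookup p x ≡ lookup q y → x ∈ p → y ∈ q
∈-by-lookup {q = q} {y = y} p[x]≡q[y] x∈p =
  lookup⇒[]= y q (trans (sym p[x]≡q[y]) ([]=⇒lookup x∈p))

∈-unionOver : ∀ {k m} {T : Subset k} {S : Fin k → Subset m} {s x} →
              s ∈ T → x ∈ S s → x ∈ unionOver T S
∈-unionOver {T = true ∷ T} here        x∈S = x∈p∪q⁺ (inj₁ x∈S)
∈-unionOver {T = b ∷ T}    (there s∈T) x∈S = x∈p∪q⁺ (inj₂ (∈-unionOver s∈T x∈S))

module _ {n} (G : ℕ → Subset n) where

  incidence : ∀ N → Fin n → Subset N
  incidence zero    i = []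
  incidence (suc t) i = lookup (G t) i ∷ incidence t i

  incidence-column : ∀ N (x : Fin N) → ∃[ t ] ∀ i → lookup (incidence N i) x ≡ lookup (G t) i
  incidence-column (suc t) zero    = t , λ i → refl
  incidence-column (suc t) (suc x) = incidence-column t x

  incidence-⊆-⋃ : ∀ {N T i} → (∀ t → i ∈ G t → ∃[ s ] s ∈ T × s ∈ G t) →
                  incidence N i ⊆ unionOver T (incidence N)
  incidence-⊆-⋃ {N} {T} {i} meets {x} x∈Sᵢ with incidence-column N x
  ... | t , column with meets t (∈-by-lookup (column i) x∈Sᵢ)
  ...   | s , s∈T , s∈Gₜ = ∈-unionOver s∈T (∈-by-lookup (sym (column s)) s∈Gₜ)

  ⋃-incidence≡⊤ : ∀ {N} → (∀ t → Nonempty (G t)) → unionOver ⊤ (incidence N) ≡ ⊤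
  ⋃-incidence≡⊤ {N} nonempty = ⊆-antisym ⊆⊤ ⊤⊆⋃
    where
    ⊤⊆⋃ : ⊤ ⊆ unionOver ⊤ (incidence N)
    ⊤⊆⋃ {x} _ with incidence-column N x
    ... | t , column with nonempty t
    ...   | s , s∈Gₜ = ∈-unionOver {S = incidence N} ∈⊤ (∈-by-lookup (sym (column s)) s∈Gₜ)

module Greedy {n} {P : Pred (Subset n) 0ℓ} (P? : Decidable P) (P⇒nonempty : ∀ {F} → P F → Nonempty F)
              (b : ℕ) {F₀ : Subset n} (PF₀ : P F₀) where

  β : ℕ
  β = suc b

  chooseLightest : (load : Fin n → ℕ) →
                   Σ[ G ∈ Subset n ] P G × (∀ F → P F → weight G ((β ^_) ∘ load) ≤ weight F ((β ^_) ∘ load))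
  chooseLightest load = lightest P? (λ F → weight F ((β ^_) ∘ load)) PF₀

  load : ℕ → Fin n → ℕ
  load zero    i = 0
  load (suc t) i = if lookup (proj₁ (chooseLightest (load t))) i then suc (load t i) else load t i

  G : ℕ → Subset n
  G t = proj₁ (chooseLightest (load t))

  weights : ℕ → Fin n → ℕ
  weights t i = β ^ load t i

  D : ℕ → ℕ
  D t = sum (weights t)

  α : ℕ → ℕ
  α t = weight (G t) (weights t)

  P[G] : ∀ t → P (G t)
  P[G] t = proj₁ (proj₂ (chooseLightest (load t)))

  α≤weight : ∀ t {F} → P F → α t ≤ weight F (weights t)
  α≤weight t {F} PF = proj₂ (proj₂ (chooseLightest (load t))) F PF

  α>0 : ∀ t → α t > 0
  α>0 t with P⇒nonempty (P[G] t)
  ... | i , i∈G = ≤-trans (m^n>0 β (load t i)) (∈⇒≤weight (weights t) i∈G)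

  α≤D : ∀ t → α t ≤ D t
  α≤D t = weight≤sum (G t) (weights t)

  D[0]≡n : D 0 ≡ n
  D[0]≡n = trans (sum-const n 1) (*-identityʳ n)

  D[1+t]≡D[t]+b*α[t] : ∀ t → D (suc t) ≡ D t + b * α t
  D[1+t]≡D[t]+b*α[t] t = begin
    sum (weights (suc t))                        ≡⟨ sum-cong-≗ reweight ⟩
    sum (λ i → weights t i + b * chosen i)        ≡⟨ ∑-distrib-+ (weights t) (λ i → b * chosen i) ⟩
    D t + sum (λ i → b * chosen i)                ≡⟨ cong (D t +_) (*-distribˡ-sum b chosen) ⟨
    D t + b * α t                                 ∎
    where
    open ≡-Reasoning
    chosen : Fin n → ℕ
    chosen i = if lookup (G t) i then weights t i else 0
    reweight : ∀ i → weights (suc t) i ≡ weights t i + b * chosen i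
    reweight i with lookup (G t) i
    ... | true  = refl
    ... | false = sym (trans (cong (weights t i +_) (*-zeroʳ b)) (+-identityʳ (weights t i)))

  D[t]≤D[1+t] : ∀ t → D t ≤ D (suc t)
  D[t]≤D[1+t] t = ≤-trans (m≤m+n (D t) (b * α t)) (≤-reflexive (sym (D[1+t]≡D[t]+b*α[t] t)))

  D-mono-≤ : ∀ {s t} → s ≤ t → D s ≤ D t
  D-mono-≤ = D-mono-≤′ ∘ ≤⇒≤′
    where
    D-mono-≤′ : ∀ {s t} → s ≤′ t → D s ≤ D t
    D-mono-≤′ ≤′-refl              = ≤-refl
    D-mono-≤′ (≤′-step {t} s≤′t) = ≤-trans (D-mono-≤′ s≤′t) (D[t]≤D[1+t] t)

  D[t]≤β^t*n : ∀ t → D t ≤ β ^ t * n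
  D[t]≤β^t*n zero    = ≤-reflexive (trans D[0]≡n (sym (+-identityʳ n)))
  D[t]≤β^t*n (suc t) = begin
    D (suc t)            ≡⟨ D[1+t]≡D[t]+b*α[t] t ⟩
    D t + b * α t        ≤⟨ +-monoʳ-≤ (D t) (*-monoʳ-≤ b (α≤D t)) ⟩
    β * D t              ≤⟨ *-monoʳ-≤ β (D[t]≤β^t*n t) ⟩
    β * (β ^ t * n)      ≡⟨ *-assoc β (β ^ t) n ⟨
    β ^ suc t * n        ∎
    where open ≤-Reasoning

  t≤D[t] : .{{_ : NonZero b}} → ∀ t → t ≤ D t
  t≤D[t] zero    = z≤n
  t≤D[t] (suc t) = begin
    suc t             ≡⟨ +-comm 1 t ⟩
    t + 1             ≤⟨ +-mono-≤ (t≤D[t] t) (*-mono-≤ (>-nonZero⁻¹ b) (α>0 t)) ⟩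
    D t + b * α t     ≡⟨ D[1+t]≡D[t]+b*α[t] t ⟨
    D (suc t)         ∎
    where open ≤-Reasoning

  growth : ∀ {V} → (∀ t → α t * V ≤ D t) → ∀ t → D (suc t) * V ≤ D t * (V + b)
  growth {V} α*V≤D t = begin
    D (suc t) * V              ≡⟨ cong (_* V) (D[1+t]≡D[t]+b*α[t] t) ⟩
    (D t + b * α t) * V        ≡⟨ *-distribʳ-+ V (D t) (b * α t) ⟩
    D t * V + b * α t * V      ≡⟨ cong (D t * V +_) (*-assoc b (α t) V) ⟩
    D t * V + b * (α t * V)    ≤⟨ +-monoʳ-≤ (D t * V) (*-monoʳ-≤ b (α*V≤D t)) ⟩
    D t * V + b * D t          ≡⟨ cong (D t * V +_) (*-comm b (D t)) ⟩
    D t * V + D t * b          ≡⟨ *-distribˡ-+ (D t) V b ⟨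
    D t * (V + b)              ∎
    where open ≤-Reasoning

  overflow : .{{_ : NonZero b}} → ∀ ℓ → ∃[ N ] (∀ i → load N i ≤ ℓ) × β ^ suc ℓ ≤ D (suc N)
  overflow ℓ =
    lastBelow (crossing {P = Overloaded} (λ t → any? (λ i → ℓ <? load t i)) (λ { (_ , ()) }) {bound} overloaded)
    where
    Overloaded : ℕ → Set
    Overloaded t = ∃[ i ] ℓ < load t i
    bound : ℕ
    bound = suc (n * β ^ ℓ)
    overloaded : Overloaded bound
    overloaded with any? (λ i → ℓ <? load bound i)
    ... | yes some = some
    ... | no none  = contradiction (begin
      bound                      ≤⟨ t≤D[t] bound ⟩
      D bound                    ≤⟨ sum-mono-≤ (λ i → ^-monoʳ-≤ β (≮⇒≥ (λ ℓ<load → none (i , ℓ<load)))) ⟩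
      sum {n} (λ _ → β ^ ℓ)      ≡⟨ sum-const n (β ^ ℓ) ⟩
      n * β ^ ℓ                  ∎) (n≮n (n * β ^ ℓ))
      where open ≤-Reasoning
    lastBelow : ∃[ N ] ¬ Overloaded N × Overloaded (suc N) →
                ∃[ N ] (∀ i → load N i ≤ ℓ) × β ^ suc ℓ ≤ D (suc N)
    lastBelow (N , ¬overloaded , (i , ℓ<load)) =
      N , (λ i → ≮⇒≥ (λ ℓ<load → ¬overloaded (i , ℓ<load))) ,
      ≤-trans (^-monoʳ-≤ β ℓ<load) (f[i]≤sum[f] (weights (suc N)) i)

  ∣incidence∣≡load : ∀ N i → ∣ incidence G N i ∣ ≡ load N i
  ∣incidence∣≡load zero    i = refl
  ∣incidence∣≡load (suc N) i with lookup (G N) i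
  ... | true  = cong suc (∣incidence∣≡load N i)
  ... | false = ∣incidence∣≡load N i

-- L and LL play the roles of ⌊log₂ n⌋ and ⌊log₂ L⌋; only the three hypotheses are used.
module Construction (n L LL : ℕ) (n<2^[1+L] : n < 2 ^ suc L) (2^LL≤L : 2 ^ LL ≤ L) (16≤LL : 16 ≤ LL)
  where

  open +-*-Solver using (solve; _:+_; _:*_; _:=_; con)

  k : ℕ
  k = ⌊ LL /2⌋

  b : ℕ
  b = 2 ^ k ∸ 1

  β : ℕ
  β = suc b

  β≡2^k : β ≡ 2 ^ k
  β≡2^k = trans (+-comm 1 b) (m∸n+n≡m (m^n>0 2 k))

  8≤k : 8 ≤ k
  8≤k = ⌊n/2⌋-mono 16≤LL

  instance
    k-nonZero : NonZero k
    k-nonZero = >-nonZero (≤-trans (s≤s z≤n) 8≤k)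

    L-nonZero : NonZero L
    L-nonZero = >-nonZero (≤-trans (m^n>0 2 LL) 2^LL≤L)

  24*k≤β : 24 * k ≤ β
  24*k≤β = subst (24 * k ≤_) (sym β≡2^k) (24*k≤2^k (≤⇒≤′ 8≤k))

  β*β≤L : β * β ≤ L
  β*β≤L = begin
    β * β          ≡⟨ cong₂ _*_ β≡2^k β≡2^k ⟩
    2 ^ k * 2 ^ k  ≡⟨ ^-distribˡ-+-* 2 k k ⟨
    2 ^ (k + k)    ≤⟨ ^-monoʳ-≤ 2 (⌊n/2⌋+⌊n/2⌋≤n LL) ⟩
    2 ^ LL         ≤⟨ 2^LL≤L ⟩
    L              ∎
    where open ≤-Reasoning

  k≤L : k ≤ L
  k≤L = ≤-trans (m≤n*m k 24) (≤-trans 24*k≤β (≤-trans (m≤m*n β β) β*β≤L))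

  -- β = 2 ^ k ≈ √L keeps the weights small, and ℓ · k ≥ 2 L + 2 makes β ^ ℓ ≥ 4 ^ (L + 1) > n ^ 2.
  ℓ : ℕ
  ℓ = suc ((suc L + suc L) / k)

  2+2L≤ℓ*k : suc L + suc L ≤ ℓ * k
  2+2L≤ℓ*k = <⇒≤ (m<[1+m/n]*n (suc L + suc L) k)

  ℓ*LL≤12*L : ℓ * LL ≤ 12 * L
  ℓ*LL≤12*L = begin
    ℓ * LL                           ≤⟨ *-monoʳ-≤ ℓ (n≤1+⌊n/2⌋+⌊n/2⌋ LL) ⟩
    ℓ * suc (k + k)                  ≤⟨ *-monoʳ-≤ ℓ (+-monoˡ-≤ (k + k) (>-nonZero⁻¹ k)) ⟩
    ℓ * (k + (k + k))                ≡⟨ solve 2 (λ l x → l :* (x :+ (x :+ x)) := con 3 :* (l :* x)) refl ℓ k ⟩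
    3 * (ℓ * k)                      ≤⟨ *-monoʳ-≤ 3 (+-monoʳ-≤ k (m/n*n≤m (suc L + suc L) k)) ⟩
    3 * (k + (suc L + suc L))        ≤⟨ *-monoʳ-≤ 3 (+-monoˡ-≤ (suc L + suc L) k≤L) ⟩
    3 * (L + (suc L + suc L))        ≡⟨ solve 1 (λ l → con 3 :* (l :+ ((con 1 :+ l) :+ (con 1 :+ l)))
                                                  := con 9 :* l :+ con 3 :* con 2) refl L ⟩
    9 * L + 3 * 2                    ≤⟨ +-monoʳ-≤ (9 * L) (*-monoʳ-≤ 3 2≤L) ⟩
    9 * L + 3 * L                    ≡⟨ *-distribʳ-+ L 9 3 ⟨
    12 * L                           ∎
    where
    open ≤-Reasoning
    2≤L : 2 ≤ L
    2≤L = ≤-trans (s≤s (s≤s z≤n)) (≤-trans 8≤k k≤L)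

  2^[1+L]*2^[1+L]≤β^ℓ : 2 ^ suc L * 2 ^ suc L ≤ β ^ ℓ
  2^[1+L]*2^[1+L]≤β^ℓ = begin
    2 ^ suc L * 2 ^ suc L   ≡⟨ ^-distribˡ-+-* 2 (suc L) (suc L) ⟨
    2 ^ (suc L + suc L)     ≤⟨ ^-monoʳ-≤ 2 (≤-trans 2+2L≤ℓ*k (≤-reflexive (*-comm ℓ k))) ⟩
    2 ^ (k * ℓ)             ≡⟨ ^-*-assoc 2 k ℓ ⟨
    (2 ^ k) ^ ℓ             ≡⟨ cong (_^ ℓ) β≡2^k ⟨
    β ^ ℓ                   ∎
    where open ≤-Reasoning

  2^[1+L]*n<β^ℓ : 2 ^ suc L * n < β ^ ℓ
  2^[1+L]*n<β^ℓ = <-≤-trans (*-monoʳ-< (2 ^ suc L) {{m^n≢0 2 (suc L)}} n<2^[1+L]) 2^[1+L]*2^[1+L]≤β^ℓ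

  smallLP-bound : ∀ N V → suc V ≤ b + b → β ^ ℓ ≤ β ^ N * n → ℓ * LL * suc V ≤ N * L
  smallLP-bound N V 1+V≤2b β^ℓ≤β^N*n = *-cancelʳ-≤ _ _ k (begin
    ℓ * LL * suc V * k        ≤⟨ *-monoˡ-≤ k (*-mono-≤ ℓ*LL≤12*L 1+V≤2b) ⟩
    12 * L * (b + b) * k      ≡⟨ solve 3 (λ l x c → con 12 :* l :* (c :+ c) :* x := l :* (con 24 :* x :* c))
                                          refl L k b ⟩
    L * (24 * k * b)          ≤⟨ *-monoʳ-≤ L (*-mono-≤ 24*k≤β (n≤1+n b)) ⟩
    L * (β * β)               ≤⟨ *-monoʳ-≤ L β*β≤L ⟩
    L * L                     ≤⟨ *-monoʳ-≤ L L≤k*N ⟩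
    L * (k * N)               ≡⟨ solve 3 (λ l x m → l :* (x :* m) := m :* l :* x) refl L k N ⟩
    N * L * k                 ∎)
    where
    open ≤-Reasoning
    2^[1+L]<2^[k*N] : 2 ^ suc L < 2 ^ (k * N)
    2^[1+L]<2^[k*N] = subst (2 ^ suc L <_) (trans (cong (_^ N) β≡2^k) (^-*-assoc 2 k N))
      (*-cancelʳ-< (2 ^ suc L) (2 ^ suc L) (β ^ N) (begin-strict
        2 ^ suc L * 2 ^ suc L     ≤⟨ 2^[1+L]*2^[1+L]≤β^ℓ ⟩
        β ^ ℓ                     ≤⟨ β^ℓ≤β^N*n ⟩
        β ^ N * n                 <⟨ *-monoʳ-< (β ^ N) {{m^n≢0 β N}} n<2^[1+L] ⟩
        β ^ N * 2 ^ suc L         ∎))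
    L≤k*N : L ≤ k * N
    L≤k*N = ≤-trans (n≤1+n L) (2^-cancel-≤ (<⇒≤ 2^[1+L]<2^[k*N]))

  largeLP-bound : ∀ N V q → 1 ≤ q → suc V ≤ suc q * (b + b) → suc L * q ≤ N → ℓ * LL * suc V ≤ N * L
  largeLP-bound N V q 1≤q 1+V≤[1+q]*2b [1+L]*q≤N = begin
    ℓ * LL * suc V                    ≤⟨ *-mono-≤ ℓ*LL≤12*L 1+V≤2q*2b ⟩
    12 * L * ((q + q) * (b + b))      ≡⟨ solve 3 (λ l y c → con 12 :* l :* ((y :+ y) :* (c :+ c))
                                                        := l :* (con 48 :* c) :* y) refl L q b ⟩
    L * (48 * b) * q                  ≤⟨ *-monoˡ-≤ q (*-monoʳ-≤ L 48*b≤L) ⟩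
    L * L * q                         ≡⟨ *-assoc L L q ⟩
    L * (L * q)                       ≤⟨ *-monoʳ-≤ L (≤-trans (*-monoˡ-≤ q (n≤1+n L)) [1+L]*q≤N) ⟩
    L * N                             ≡⟨ *-comm L N ⟩
    N * L                             ∎
    where
    open ≤-Reasoning
    1+V≤2q*2b : suc V ≤ (q + q) * (b + b)
    1+V≤2q*2b = ≤-trans 1+V≤[1+q]*2b (*-monoˡ-≤ (b + b) (+-monoˡ-≤ q 1≤q))
    48≤β : 48 ≤ β
    48≤β = ≤-trans (m≤m+n 48 144) (≤-trans (*-monoʳ-≤ 24 8≤k) 24*k≤β)
    48*b≤L : 48 * b ≤ L
    48*b≤L = ≤-trans (*-mono-≤ 48≤β (n≤1+n b)) β*β≤L

  toℚ-ℓ*LL≤12*L : toℚ ℓ ℚ.* toℚ LL ℚ.≤ toℚ 12 ℚ.* toℚ L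
  toℚ-ℓ*LL≤12*L = subst₂ ℚ._≤_ (toℚ-* ℓ LL) (toℚ-* 12 L) (toℚ-mono-≤ ℓ*LL≤12*L)

  instance
    b-nonZero : NonZero b
    b-nonZero = >-nonZero (s≤s⁻¹ (subst (2 ≤_) (sym β≡2^k) (^-monoʳ-≤ 2 (>-nonZero⁻¹ k))))

  DimensionBound : ℚ → ℕ → Set
  DimensionBound v m = 1ℚ ℚ.* toℚ LL ℚ.* toℚ ℓ ℚ.* v ℚ.≤ toℚ m ℚ.* toℚ L

  LP-bound : ∀ m u {v} → ℓ * LL * u ≤ m * L → v ℚ.≤ toℚ u → DimensionBound v m
  LP-bound m u {v} ℓ*LL*u≤m*L v≤u =
    subst₂ ℚ._≤_ (cong (ℚ._* v) coefficient) (toℚ-* m L) (toℚ[c]*v≤toℚ[M] {ℓ * LL} {u} ℓ*LL*u≤m*L v≤u)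
    where
    coefficient : toℚ (ℓ * LL) ≡ 1ℚ ℚ.* toℚ LL ℚ.* toℚ ℓ
    coefficient = trans (toℚ-* ℓ LL)
      (trans (ℚ.*-comm (toℚ ℓ) (toℚ LL)) (cong (ℚ._* toℚ ℓ) (sym (ℚ.*-identityˡ (toℚ LL)))))

  SpanoidCode : Spanoid n → Set
  SpanoidCode 𝒮 = Σ[ m ∈ ℕ ] Σ[ S ∈ (Fin n → Subset m) ]
    (∀ i → ∣ S i ∣ ≤ ℓ)
    × (∀ T i → 𝒮 ⊢ T ⊨ i → S i ⊆ unionOver T S)
    × (∀ v → IsLPcover 𝒮 v → DimensionBound v ∣ unionOver ⊤ S ∣)

  -- Without nonempty open sets the zero vector is a feasible cover, so LP^cover ≤ 0.
  emptyCode : ∀ {𝒮} → (∀ F → ¬ NonemptyOpen 𝒮 F) → SpanoidCode 𝒮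
  emptyCode {𝒮} noOpen = 0 , S₀ , (λ _ → z≤n) , (λ _ _ _ ()) , λ v (_ , v≤feasible) →
    LP-bound ∣ unionOver ⊤ S₀ ∣ 0 (≤-trans (≤-reflexive (*-zeroʳ (ℓ * LL))) z≤n)
      (subst (v ℚ.≤_) (sumℚ-zero n) (v≤feasible (λ _ → 0ℚ) zero-feasible))
    where
    S₀ : Fin n → Subset 0
    S₀ _ = []
    zero-feasible : FeasibleCover 𝒮 (λ _ → 0ℚ)
    zero-feasible = (λ _ → ℚ.≤-refl) , λ F F-min → contradiction (MinOpen⇒NonemptyOpen F-min) (noOpen F)

  module GreedyCode (𝒮 : Spanoid n) {F₀} (F₀-open : NonemptyOpen 𝒮 F₀) where

    open Greedy (nonemptyOpen? 𝒮) proj₁ b F₀-open hiding (β)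

    N : ℕ
    N = proj₁ (overflow ℓ)

    S : Fin n → Subset N
    S = incidence G N

    sizes : ∀ i → ∣ S i ∣ ≤ ℓ
    sizes i = subst (_≤ ℓ) (sym (∣incidence∣≡load N i)) (proj₁ (proj₂ (overflow ℓ)) i)

    closure : ∀ T i → 𝒮 ⊢ T ⊨ i → S i ⊆ unionOver T S
    closure T i T⊨i = incidence-⊆-⋃ G (λ t → open-meets-⊨ (proj₂ (P[G] t)) T⊨i)

    ∣U∣≡N : ∣ unionOver ⊤ S ∣ ≡ N
    ∣U∣≡N = trans (cong ∣_∣ (⋃-incidence≡⊤ G (proj₁ ∘ P[G]))) (∣⊤∣≡n N)

    α*V≤D : ∀ {v} → (∀ y → FeasibleCover 𝒮 y → v ℚ.≤ sumℚ y) →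
            ∀ {V} → toℚ V ℚ.≤ v → ∀ t → α t * V ≤ D t
    α*V≤D {v} v≤feasible {V} V≤v t = toℚ-cancel-≤ (begin
      toℚ (α t * V)          ≡⟨ toℚ-* (α t) V ⟩
      toℚ (α t) ℚ.* toℚ V    ≤⟨ ℚ.*-monoˡ-≤-nonNeg (toℚ (α t)) {{toℚ-nonNeg (α t)}} V≤v ⟩
      toℚ (α t) ℚ.* v        ≤⟨ *-LPcover≤sum (weights t) (α t) {{>-nonZero (α>0 t)}} v≤feasible
                                  (λ F F-min → α≤weight t (MinOpen⇒NonemptyOpen F-min)) ⟩
      toℚ (D t)              ∎)
      where open ℚ.≤-Reasoning

    -- If V < 2 b, compare β ^ (ℓ + 1) ≤ D (N + 1) ≤ β ^ (N + 1) · n; otherwise D at most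
    -- doubles every q = ⌊V / 2 b⌋ rounds, which forces N ≥ (L + 1) q.
    rounds : ∀ V → (∀ t → α t * V ≤ D t) → ℓ * LL * suc V ≤ N * L
    rounds V α*V≤D with b + b ≤? V
    ... | no 2b≰V = smallLP-bound N V (≰⇒> 2b≰V) (*-cancelˡ-≤ β (begin
      β * β ^ ℓ          ≤⟨ proj₂ (proj₂ (overflow ℓ)) ⟩
      D (suc N)          ≤⟨ D[t]≤β^t*n (suc N) ⟩
      β * β ^ N * n      ≡⟨ *-assoc β (β ^ N) n ⟩
      β * (β ^ N * n)    ∎))
      where open ≤-Reasoning
    ... | yes 2b≤V = largeLP-bound N V q (m≥n⇒m/n>0 2b≤V) 1+V≤[1+q]*2b [1+L]*q≤N
      where
      instance
        2b-nonZero : NonZero (b + b)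
        2b-nonZero = >-nonZero (≤-trans (>-nonZero⁻¹ b) (m≤m+n b b))
        V-nonZero : NonZero V
        V-nonZero = >-nonZero (≤-trans (>-nonZero⁻¹ (b + b)) 2b≤V)
      q : ℕ
      q = V / (b + b)
      1+V≤[1+q]*2b : suc V ≤ suc q * (b + b)
      1+V≤[1+q]*2b = m<[1+m/n]*n V (b + b)
      2bq≤V : b * q + b * q ≤ V
      2bq≤V = subst (_≤ V) (trans (*-distribˡ-+ q b b) (cong₂ _+_ (*-comm q b) (*-comm q b)))
                          (m/n*n≤m V (b + b))
      open BoundedGrowth D b V (growth α*V≤D)
      [1+L]*q≤N : suc L * q ≤ N
      [1+L]*q≤N = ≮⇒≥ λ N<[1+L]*q → <-irrefl refl (begin-strict
        D (suc N)              ≤⟨ D-mono-≤ N<[1+L]*q ⟩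
        D (suc L * q)          ≤⟨ D[j*q]≤2^j*D[0] q 2bq≤V (suc L) ⟩
        2 ^ suc L * D 0        ≡⟨ cong (2 ^ suc L *_) D[0]≡n ⟩
        2 ^ suc L * n          <⟨ 2^[1+L]*n<β^ℓ ⟩
        β ^ ℓ                  ≤⟨ m≤n*m (β ^ ℓ) β ⟩
        β * β ^ ℓ              ≤⟨ proj₂ (proj₂ (overflow ℓ)) ⟩
        D (suc N)              ∎)
        where open ≤-Reasoning

    code : SpanoidCode 𝒮
    code = N , S , sizes , closure , lp-bound
      where
      lp-bound : ∀ v → IsLPcover 𝒮 v → DimensionBound v ∣ unionOver ⊤ S ∣
      lp-bound v ((x , (x≥0 , _) , Σx≡v) , v≤feasible) =
        viaFloor (floorℕ v (subst (0ℚ ℚ.≤_) Σx≡v (sumℚ-nonNeg x≥0)))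
        where
        viaFloor : ∃[ V ] toℚ V ℚ.≤ v × v ℚ.≤ toℚ (suc V) → DimensionBound v ∣ unionOver ⊤ S ∣
        viaFloor (V , V≤v , v≤1+V) = LP-bound ∣ unionOver ⊤ S ∣ (suc V)
          (subst (λ m → ℓ * LL * suc V ≤ m * L) (sym ∣U∣≡N) (rounds V (α*V≤D v≤feasible V≤v))) v≤1+V

  spanoidCode : ∀ 𝒮 → SpanoidCode 𝒮
  spanoidCode 𝒮 with anySubset? (nonemptyOpen? 𝒮)
  ... | yes (F₀ , F₀-open) = GreedyCode.code 𝒮 F₀-open
  ... | no ∄open          = emptyCode (λ F F-open → ∄open (F , F-open))

mainTheorem15 :
    Σ ℚ λ C₁ → Σ ℚ λ C₂ → ℚ.Positive C₁ × ℚ.Positive C₂ × Σ ℕ λ n₀ →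
      ∀ n → n₀ ≤ n → (𝒮 : Spanoid n) →
        Σ ℕ λ ℓ → 1 ≤ ℓ × Σ ℕ λ m → Σ (Fin n → Subset m) λ S →
          (∀ i → ∣ S i ∣ ≤ ℓ)
          × (∀ T i → 𝒮 ⊢ T ⊨ i → S i ⊆ unionOver T S)
          -- ℓ ≤ C₁ · log n / log log n
          × (toℚ ℓ ℚ.* toℚ ⌊log₂ ⌊log₂ n ⌋ ⌋ ℚ.≤ C₁ ℚ.* toℚ ⌊log₂ n ⌋)
          -- dim C = |U| / ℓ ≥ C₂ · (log log n / log n) · LP^cover(𝒮)
          × (∀ v → IsLPcover 𝒮 v →
               C₂ ℚ.* toℚ ⌊log₂ ⌊log₂ n ⌋ ⌋ ℚ.* toℚ ℓ ℚ.* v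
                 ℚ.≤ toℚ ∣ unionOver ⊤ S ∣ ℚ.* toℚ ⌊log₂ n ⌋)
mainTheorem15 = toℚ 12 , 1ℚ , toℚ-pos 12 , _ , 2 ^ 2 ^ 16 , λ n n₀≤n 𝒮 →
  let open Construction n ⌊log₂ n ⌋ ⌊log₂ ⌊log₂ n ⌋ ⌋ (n<2^[1+⌊log₂n⌋] n)
                        (2^⌊log₂⌊log₂n⌋⌋≤⌊log₂n⌋ n₀≤n) (16≤⌊log₂⌊log₂n⌋⌋ n₀≤n)
      (m , S , sizes , closure , lp-bound) = spanoidCode 𝒮
  in ℓ , s≤s z≤n , m , S , sizes , closure , toℚ-ℓ*LL≤12*L , lp-bound
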